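{- The map $\sigma$ sends self-dual $L$-codes to self-dual Kleinian codes, and even $L$-codes to even Kleinian codes.
   Context: Let $L=\{0,1,\omega,\bar\omega\}$ and $K=\{0,a,b,c\}$ both denote the Klein four-group $\mathbf{Z}_2\times\mathbf{Z}_2$. On $L$: $|0|^2=0$, $|1|^2=1$, $|\omega|^2=|\bar\omega|^2=2$, dot product $x\cdot y=1$ iff $x,y$ distinct and nonzero; on $L^n$, $(\mathbf{x},\mathbf{y})=\sum_i x_i\cdot y_i$ and $\mathrm{ewt}(\mathbf{x})=\sum_i|x_i|^2$. An $L$-code $C\subseteq L^n$ (subgroup) is even if all its elements have even Euclidean weight. On $K$ the dot product is likewise $x\cdot y=1$ iff $x,y$ distinct and nonzero, extended to $K^m$ by summing coordinates; a Kleinian code $E\subseteq K^m$ (subgroup) is even if every element has an even number of nonzero coordinates. In both settings a code is self-dual if it equals $\{\mathbf{z}:(\mathbf{z},\mathbf{y})=0\ \forall\mathbf{y}\in\text{code}\}$. Let $\widetilde{\ }:L^n\to K^{2n}$ send $(c_1,\dots,c_n)$ to the concatenation of the pairs $0\mapsto(0,0)$, $1\mapsto(0,a)$, $\omega\mapsto(b,b)$, $\bar\omega\mapsto(b,c)$, and let $\delta_2^n=\{(0,0),(a,a)\}^n$. For an $L$-code $C\subseteq L^n$, $\sigma(C)=\widetilde{C}+\delta_2^n\subseteq K^{2n}$. -}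

module Defs where

open import Data.Nat using (ℕ; zero; suc; _+_)
open import Data.Nat.Divisibility using (_∣_)
open import Data.Bool using (Bool; true; false; _xor_)
open import Data.Vec using (Vec; []; _∷_; replicate; zipWith)
open import Data.Product using (Σ; _×_; ∃; ∃-syntax)
open import Data.Sum using (_⊎_)
open import Data.Unit using (⊤)
open import Relation.Binary.PropositionalEquality using (_≡_)

data L : Set where
  0L 1L ω ω̄ : L

data K : Set where
  0K a b c : K

_+L_ : L → L → L
0L +L y  = y
x  +L 0L = x
1L +L 1L = 0L
1L +L ω  = ω̄
1L +L ω̄  = ω
ω  +L 1L = ω̄
ω  +L ω  = 0L
ω  +L ω̄  = 1L
ω̄  +L 1L = ω
ω̄  +L ω  = 1L
ω̄  +L ω̄  = 0L

_+K_ : K → K → K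
0K +K y  = y
x  +K 0K = x
a  +K a  = 0K
a  +K b  = c
a  +K c  = b
b  +K a  = c
b  +K b  = 0K
b  +K c  = a
c  +K a  = b
c  +K b  = a
c  +K c  = 0K

_·L_ : L → L → Bool
0L ·L _  = false
_  ·L 0L = false
1L ·L 1L = false
ω  ·L ω  = false
ω̄  ·L ω̄  = false
_  ·L _  = true

_·K_ : K → K → Bool
0K ·K _  = false
_  ·K 0K = false
a  ·K a  = false
b  ·K b  = false
c  ·K c  = false
_  ·K _  = true

norm : L → ℕ
norm 0L = 0
norm 1L = 1
norm ω  = 2
norm ω̄  = 2

isNonzeroK : K → ℕ
isNonzeroK 0K = 0
isNonzeroK _  = 1

⟪_,_⟫L : ∀ {n} → Vec L n → Vec L n → Bool
⟪ [] , [] ⟫L = false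
⟪ x ∷ xs , y ∷ ys ⟫L = (x ·L y) xor ⟪ xs , ys ⟫L

⟪_,_⟫K : ∀ {m} → Vec K m → Vec K m → Bool
⟪ [] , [] ⟫K = false
⟪ x ∷ xs , y ∷ ys ⟫K = (x ·K y) xor ⟪ xs , ys ⟫K

ewt : ∀ {n} → Vec L n → ℕ
ewt [] = 0
ewt (x ∷ xs) = norm x + ewt xs

wtK : ∀ {m} → Vec K m → ℕ
wtK [] = 0
wtK (x ∷ xs) = isNonzeroK x + wtK xs

LSubset : ℕ → Set₁
LSubset n = Vec L n → Set

KSubset : ℕ → Set₁
KSubset m = Vec K m → Set

-- subgroup of L^n (every element is its own inverse, so 0 and + suffice)
record IsLCode {n : ℕ} (C : LSubset n) : Set where
  field
    zero-mem : C (replicate n 0L)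
    +-closed : ∀ x y → C x → C y → C (zipWith _+L_ x y)

record IsKCode {m : ℕ} (E : KSubset m) : Set where
  field
    zero-mem : E (replicate m 0K)
    +-closed : ∀ x y → E x → E y → E (zipWith _+K_ x y)

IsSelfDualLCode : ∀ {n} → LSubset n → Set
IsSelfDualLCode C =
  IsLCode C × (∀ z → (C z → ∀ y → C y → ⟪ z , y ⟫L ≡ false)
                   × ((∀ y → C y → ⟪ z , y ⟫L ≡ false) → C z))

IsSelfDualKCode : ∀ {m} → KSubset m → Set
IsSelfDualKCode E =
  IsKCode E × (∀ z → (E z → ∀ y → E y → ⟪ z , y ⟫K ≡ false)
                   × ((∀ y → E y → ⟪ z , y ⟫K ≡ false) → E z))

IsEvenLCode : ∀ {n} → LSubset n → Set
IsEvenLCode C = IsLCode C × (∀ x → C x → 2 ∣ ewt x)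

IsEvenKCode : ∀ {m} → KSubset m → Set
IsEvenKCode E = IsKCode E × (∀ x → E x → 2 ∣ wtK x)

-- 2n, defined so that it peels off two coordinates at a time
double : ℕ → ℕ
double zero = zero
double (suc n) = suc (suc (double n))

tilde : ∀ {n} → Vec L n → Vec K (double n)
tilde [] = []
tilde (0L ∷ xs) = 0K ∷ 0K ∷ tilde xs
tilde (1L ∷ xs) = 0K ∷ a  ∷ tilde xs
tilde (ω  ∷ xs) = b  ∷ b  ∷ tilde xs
tilde (ω̄  ∷ xs) = b  ∷ c  ∷ tilde xs

δ₂ : ∀ n → KSubset (double n)
δ₂ zero [] = ⊤
δ₂ (suc n) (x ∷ y ∷ ws) = ((x ≡ 0K × y ≡ 0K) ⊎ (x ≡ a × y ≡ a)) × δ₂ n ws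

σ : ∀ {n} → LSubset n → KSubset (double n)
σ {n} C w = ∃[ x ] ∃[ d ] (C x × δ₂ n d × w ≡ zipWith _+K_ (tilde x) d)

module Submission where

-- Write ⊕ for coordinatewise addition in K^m.  The proof rests on four facts
-- about the map ~ : L^n → K^{2n} and the subgroup δ = δ₂^n of K^{2n}:
--   (1) ~ is a group homomorphism and an isometry: (x̃ , ỹ) = (x , y);
--   (2) δ is self-orthogonal and orthogonal to every x̃;
--   (3) the dual of δ is exactly ~(L^n) ⊕ δ;
--   (4) wt(x̃ ⊕ d) ≡ ewt(x) (mod 2) for d ∈ δ.
-- By (1) and (2) σ(C) = C̃ ⊕ δ is a code, self-orthogonal when C is.  If z is
-- orthogonal to σ(C) ⊇ δ, then (3) writes z = x̃ ⊕ d, and (1), (2) give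
-- (x , y) = (z , ỹ) = 0 for y ∈ C, so x ∈ C and z ∈ σ(C): this is
-- self-duality.  Evenness is immediate from (4).

open import Defs
open import Data.Nat using (ℕ; zero; suc; _+_; _%_)
open import Data.Nat as ℕ using ()
open import Data.Nat.Properties using (+-assoc)
open import Data.Nat.DivMod using (%-distribˡ-+)
open import Data.Nat.Divisibility using (_∣_; m%n≡0⇒n∣m; n∣m⇒m%n≡0)
open import Data.Bool using (false; _xor_)
open import Data.Bool.Properties using (xor-assoc; xor-identityʳ; xor-∧-commutativeRing)
  renaming (_≟_ to _≟B_)
open import Algebra.Bundles using (CommutativeRing)
open import Algebra.Properties.CommutativeSemigroup
  (CommutativeRing.+-commutativeSemigroup xor-∧-commutativeRing)
  using () renaming (interchange to xor-interchange)
open import Data.Vec using (Vec; []; _∷_; replicate; zipWith)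
open import Data.Vec.Properties using (zipWith-identityˡ; zipWith-identityʳ)
open import Data.Product using (_×_; _,_; ∃-syntax; proj₁; proj₂)
open import Data.Sum using (_⊎_; inj₁; inj₂)
open import Data.Unit using (tt)
open import Relation.Nullary.Decidable using (Dec; map′; _×-dec_; from-yes)
open import Relation.Unary using (Decidable)
open import Relation.Binary.Definitions using (DecidableEquality)
open import Relation.Binary.PropositionalEquality
  using (_≡_; refl; sym; trans; cong; cong₂; module ≡-Reasoning)
open ≡-Reasoning

codeK : K → ℕ
codeK 0K = 0
codeK a  = 1
codeK b  = 2
codeK c  = 3

decodeK : ℕ → K
decodeK 0 = 0K
decodeK 1 = a
decodeK 2 = b
decodeK _ = c

decode-code : ∀ p → decodeK (codeK p) ≡ p
decode-code 0K = refl
decode-code a  = refl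
decode-code b  = refl
decode-code c  = refl

_≟K_ : DecidableEquality K
p ≟K q = map′ codeK-injective (cong codeK) (codeK p ℕ.≟ codeK q)
  where
  codeK-injective : codeK p ≡ codeK q → p ≡ q
  codeK-injective eq =
    trans (sym (decode-code p)) (trans (cong decodeK eq) (decode-code q))

-- A decidable property holds on all of K (resp. L) iff it holds on each of
-- the four elements; with 'from-yes' this proves finite identities by
-- evaluation.
∀K? : {P : K → Set} → Decidable P → Dec (∀ p → P p)
∀K? P? = map′ (λ (p₀ , pa , pb , pc) → λ { 0K → p₀ ; a → pa ; b → pb ; c → pc })
              (λ all → all 0K , all a , all b , all c)
              (P? 0K ×-dec P? a ×-dec P? b ×-dec P? c)

∀L? : {P : L → Set} → Decidable P → Dec (∀ u → P u)
∀L? P? = map′ (λ (p₀ , p₁ , pω , pω̄) → λ { 0L → p₀ ; 1L → p₁ ; ω → pω ; ω̄ → pω̄ })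
              (λ all → all 0L , all 1L , all ω , all ω̄)
              (P? 0L ×-dec P? 1L ×-dec P? ω ×-dec P? ω̄)

+K-identityʳ : ∀ p → p +K 0K ≡ p
+K-identityʳ = from-yes (∀K? λ p → (p +K 0K) ≟K p)

+K-interchange : ∀ p q r s → (p +K q) +K (r +K s) ≡ (p +K r) +K (q +K s)
+K-interchange = from-yes (∀K? λ p → ∀K? λ q → ∀K? λ r → ∀K? λ s →
  ((p +K q) +K (r +K s)) ≟K ((p +K r) +K (q +K s)))

·K-comm : ∀ p q → p ·K q ≡ q ·K p
·K-comm = from-yes (∀K? λ p → ∀K? λ q → (p ·K q) ≟B (q ·K p))

·K-linearˡ : ∀ p q r → (p +K q) ·K r ≡ (p ·K r) xor (q ·K r)
·K-linearˡ = from-yes (∀K? λ p → ∀K? λ q → ∀K? λ r →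
  ((p +K q) ·K r) ≟B ((p ·K r) xor (q ·K r)))

·K-zeroʳ : ∀ p → p ·K 0K ≡ false
·K-zeroʳ = from-yes (∀K? λ p → (p ·K 0K) ≟B false)

tilde₁ tilde₂ : L → K
tilde₁ 0L = 0K
tilde₁ 1L = 0K
tilde₁ ω  = b
tilde₁ ω̄  = b
tilde₂ 0L = 0K
tilde₂ 1L = a
tilde₂ ω  = b
tilde₂ ω̄  = c

tilde-cons : ∀ {n} u (x : Vec L n) → tilde (u ∷ x) ≡ tilde₁ u ∷ tilde₂ u ∷ tilde x
tilde-cons 0L x = refl
tilde-cons 1L x = refl
tilde-cons ω  x = refl
tilde-cons ω̄  x = refl

tilde₁-hom : ∀ u v → tilde₁ (u +L v) ≡ tilde₁ u +K tilde₁ v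
tilde₁-hom = from-yes (∀L? λ u → ∀L? λ v → tilde₁ (u +L v) ≟K (tilde₁ u +K tilde₁ v))

tilde₂-hom : ∀ u v → tilde₂ (u +L v) ≡ tilde₂ u +K tilde₂ v
tilde₂-hom = from-yes (∀L? λ u → ∀L? λ v → tilde₂ (u +L v) ≟K (tilde₂ u +K tilde₂ v))

tilde-pair-dot : ∀ u v → (tilde₁ u ·K tilde₁ v) xor (tilde₂ u ·K tilde₂ v) ≡ u ·L v
tilde-pair-dot = from-yes (∀L? λ u → ∀L? λ v →
  ((tilde₁ u ·K tilde₁ v) xor (tilde₂ u ·K tilde₂ v)) ≟B (u ·L v))

δPair : K → K → Set
δPair e₁ e₂ = (e₁ ≡ 0K × e₂ ≡ 0K) ⊎ (e₁ ≡ a × e₂ ≡ a)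

δPair-closed : ∀ {e₁ e₂ f₁ f₂} → δPair e₁ e₂ → δPair f₁ f₂ → δPair (e₁ +K f₁) (e₂ +K f₂)
δPair-closed (inj₁ (refl , refl)) (inj₁ (refl , refl)) = inj₁ (refl , refl)
δPair-closed (inj₁ (refl , refl)) (inj₂ (refl , refl)) = inj₂ (refl , refl)
δPair-closed (inj₂ (refl , refl)) (inj₁ (refl , refl)) = inj₂ (refl , refl)
δPair-closed (inj₂ (refl , refl)) (inj₂ (refl , refl)) = inj₁ (refl , refl)

δPair-orthogonal : ∀ {e₁ e₂ f₁ f₂} → δPair e₁ e₂ → δPair f₁ f₂ →
  (e₁ ·K f₁) xor (e₂ ·K f₂) ≡ false
δPair-orthogonal (inj₁ (refl , refl)) (inj₁ (refl , refl)) = refl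
δPair-orthogonal (inj₁ (refl , refl)) (inj₂ (refl , refl)) = refl
δPair-orthogonal (inj₂ (refl , refl)) (inj₁ (refl , refl)) = refl
δPair-orthogonal (inj₂ (refl , refl)) (inj₂ (refl , refl)) = refl

tilde-⊥-δPair : ∀ u {e₁ e₂} → δPair e₁ e₂ → (tilde₁ u ·K e₁) xor (tilde₂ u ·K e₂) ≡ false
tilde-⊥-δPair u (inj₁ (refl , refl)) =
  from-yes (∀L? λ u → ((tilde₁ u ·K 0K) xor (tilde₂ u ·K 0K)) ≟B false) u
tilde-⊥-δPair u (inj₂ (refl , refl)) =
  from-yes (∀L? λ u → ((tilde₁ u ·K a) xor (tilde₂ u ·K a)) ≟B false) u

δPair-weight : ∀ u {e₁ e₂} → δPair e₁ e₂ →
  (isNonzeroK (tilde₁ u +K e₁) + isNonzeroK (tilde₂ u +K e₂)) % 2 ≡ norm u % 2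
δPair-weight u (inj₁ (refl , refl)) = from-yes (∀L? λ u →
  ((isNonzeroK (tilde₁ u +K 0K) + isNonzeroK (tilde₂ u +K 0K)) % 2) ℕ.≟ (norm u % 2)) u
δPair-weight u (inj₂ (refl , refl)) = from-yes (∀L? λ u →
  ((isNonzeroK (tilde₁ u +K a) + isNonzeroK (tilde₂ u +K a)) % 2) ℕ.≟ (norm u % 2)) u

δPair-dual : ∀ p q → (p ·K a) xor (q ·K a) ≡ false →
  ∃[ u ] ∃[ e₁ ] ∃[ e₂ ] (δPair e₁ e₂ × p ≡ tilde₁ u +K e₁ × q ≡ tilde₂ u +K e₂)
δPair-dual 0K 0K _ = 0L , 0K , 0K , inj₁ (refl , refl) , refl , refl
δPair-dual a  a  _ = 0L , a  , a  , inj₂ (refl , refl) , refl , refl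
δPair-dual 0K a  _ = 1L , 0K , 0K , inj₁ (refl , refl) , refl , refl
δPair-dual a  0K _ = 1L , a  , a  , inj₂ (refl , refl) , refl , refl
δPair-dual b  b  _ = ω  , 0K , 0K , inj₁ (refl , refl) , refl , refl
δPair-dual c  c  _ = ω  , a  , a  , inj₂ (refl , refl) , refl , refl
δPair-dual b  c  _ = ω̄  , 0K , 0K , inj₁ (refl , refl) , refl , refl
δPair-dual c  b  _ = ω̄  , a  , a  , inj₂ (refl , refl) , refl , refl
δPair-dual 0K b  ()
δPair-dual 0K c  ()
δPair-dual a  b  ()
δPair-dual a  c  ()
δPair-dual b  0K ()
δPair-dual b  a  ()
δPair-dual c  0K ()
δPair-dual c  a  ()

infixl 6 _⊕_
_⊕_ : ∀ {m} → Vec K m → Vec K m → Vec K m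
_⊕_ = zipWith _+K_

⊕-identityʳ : ∀ {m} (v : Vec K m) → v ⊕ replicate m 0K ≡ v
⊕-identityʳ = zipWith-identityʳ +K-identityʳ

⊕-identityˡ : ∀ {m} (v : Vec K m) → replicate m 0K ⊕ v ≡ v
⊕-identityˡ = zipWith-identityˡ (λ _ → refl)

⊕-interchange : ∀ {m} (s t u v : Vec K m) → (s ⊕ t) ⊕ (u ⊕ v) ≡ (s ⊕ u) ⊕ (t ⊕ v)
⊕-interchange []      []      []      []      = refl
⊕-interchange (p ∷ s) (q ∷ t) (r ∷ u) (o ∷ v) =
  cong₂ _∷_ (+K-interchange p q r o) (⊕-interchange s t u v)

dot-comm : ∀ {m} (u v : Vec K m) → ⟪ u , v ⟫K ≡ ⟪ v , u ⟫K
dot-comm []      []      = refl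
dot-comm (p ∷ u) (q ∷ v) = cong₂ _xor_ (·K-comm p q) (dot-comm u v)

dot-linearˡ : ∀ {m} (u v w : Vec K m) → ⟪ u ⊕ v , w ⟫K ≡ ⟪ u , w ⟫K xor ⟪ v , w ⟫K
dot-linearˡ []      []      []      = refl
dot-linearˡ (p ∷ u) (q ∷ v) (r ∷ w) = begin
  ((p +K q) ·K r) xor ⟪ u ⊕ v , w ⟫K
    ≡⟨ cong₂ _xor_ (·K-linearˡ p q r) (dot-linearˡ u v w) ⟩
  ((p ·K r) xor (q ·K r)) xor (⟪ u , w ⟫K xor ⟪ v , w ⟫K)
    ≡⟨ xor-interchange (p ·K r) (q ·K r) ⟪ u , w ⟫K ⟪ v , w ⟫K ⟩
  ((p ·K r) xor ⟪ u , w ⟫K) xor ((q ·K r) xor ⟪ v , w ⟫K) ∎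

dot-linearʳ : ∀ {m} (w u v : Vec K m) → ⟪ w , u ⊕ v ⟫K ≡ ⟪ w , u ⟫K xor ⟪ w , v ⟫K
dot-linearʳ w u v = begin
  ⟪ w , u ⊕ v ⟫K                ≡⟨ dot-comm w (u ⊕ v) ⟩
  ⟪ u ⊕ v , w ⟫K                ≡⟨ dot-linearˡ u v w ⟩
  ⟪ u , w ⟫K xor ⟪ v , w ⟫K     ≡⟨ cong₂ _xor_ (dot-comm u w) (dot-comm v w) ⟩
  ⟪ w , u ⟫K xor ⟪ w , v ⟫K     ∎

dot-zeroʳ : ∀ {m} (v : Vec K m) → ⟪ v , replicate m 0K ⟫K ≡ false
dot-zeroʳ []      = refl
dot-zeroʳ (p ∷ v) = cong₂ _xor_ (·K-zeroʳ p) (dot-zeroʳ v)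

dot-pair : ∀ {m} p q r s (u v : Vec K m) →
  ⟪ p ∷ q ∷ u , r ∷ s ∷ v ⟫K ≡ ((p ·K r) xor (q ·K s)) xor ⟪ u , v ⟫K
dot-pair p q r s u v = sym (xor-assoc (p ·K r) (q ·K s) ⟪ u , v ⟫K)

tilde-hom : ∀ {n} (x y : Vec L n) → tilde (zipWith _+L_ x y) ≡ tilde x ⊕ tilde y
tilde-hom []      []      = refl
tilde-hom (u ∷ x) (v ∷ y) = begin
  tilde ((u +L v) ∷ zipWith _+L_ x y)
    ≡⟨ tilde-cons (u +L v) (zipWith _+L_ x y) ⟩
  tilde₁ (u +L v) ∷ tilde₂ (u +L v) ∷ tilde (zipWith _+L_ x y)
    ≡⟨ cong₂ _∷_ (tilde₁-hom u v) (cong₂ _∷_ (tilde₂-hom u v) (tilde-hom x y)) ⟩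
  (tilde₁ u ∷ tilde₂ u ∷ tilde x) ⊕ (tilde₁ v ∷ tilde₂ v ∷ tilde y)
    ≡⟨ sym (cong₂ _⊕_ (tilde-cons u x) (tilde-cons v y)) ⟩
  tilde (u ∷ x) ⊕ tilde (v ∷ y) ∎

tilde-zero : ∀ n → tilde (replicate n 0L) ≡ replicate (double n) 0K
tilde-zero zero    = refl
tilde-zero (suc n) = cong (λ t → 0K ∷ 0K ∷ t) (tilde-zero n)

tilde-isometry : ∀ {n} (x y : Vec L n) → ⟪ tilde x , tilde y ⟫K ≡ ⟪ x , y ⟫L
tilde-isometry []      []      = refl
tilde-isometry (u ∷ x) (v ∷ y) = begin
  ⟪ tilde (u ∷ x) , tilde (v ∷ y) ⟫K
    ≡⟨ cong₂ ⟪_,_⟫K (tilde-cons u x) (tilde-cons v y) ⟩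
  ⟪ tilde₁ u ∷ tilde₂ u ∷ tilde x , tilde₁ v ∷ tilde₂ v ∷ tilde y ⟫K
    ≡⟨ dot-pair (tilde₁ u) (tilde₂ u) (tilde₁ v) (tilde₂ v) (tilde x) (tilde y) ⟩
  ((tilde₁ u ·K tilde₁ v) xor (tilde₂ u ·K tilde₂ v)) xor ⟪ tilde x , tilde y ⟫K
    ≡⟨ cong₂ _xor_ (tilde-pair-dot u v) (tilde-isometry x y) ⟩
  (u ·L v) xor ⟪ x , y ⟫L ∎

δ₂-zero : ∀ n → δ₂ n (replicate (double n) 0K)
δ₂-zero zero    = tt
δ₂-zero (suc n) = inj₁ (refl , refl) , δ₂-zero n

δ₂-closed : ∀ n {d d' : Vec K (double n)} → δ₂ n d → δ₂ n d' → δ₂ n (d ⊕ d')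
δ₂-closed zero    {[]}        {[]}        _         _           = tt
δ₂-closed (suc n) {_ ∷ _ ∷ _} {_ ∷ _ ∷ _} (pe , δd) (pe' , δd') =
  δPair-closed pe pe' , δ₂-closed n δd δd'

δ₂-selfOrthogonal : ∀ n {d d' : Vec K (double n)} → δ₂ n d → δ₂ n d' → ⟪ d , d' ⟫K ≡ false
δ₂-selfOrthogonal zero    {[]}          {[]}            _         _           = refl
δ₂-selfOrthogonal (suc n) {e₁ ∷ e₂ ∷ d} {f₁ ∷ f₂ ∷ d'} (pe , δd) (pe' , δd') =
  trans (dot-pair e₁ e₂ f₁ f₂ d d')
        (cong₂ _xor_ (δPair-orthogonal pe pe') (δ₂-selfOrthogonal n δd δd'))

tilde-⊥-δ₂ : ∀ {n} (x : Vec L n) {d : Vec K (double n)} → δ₂ n d → ⟪ tilde x , d ⟫K ≡ false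
tilde-⊥-δ₂ []      {[]}            _         = refl
tilde-⊥-δ₂ (u ∷ x) {e₁ ∷ e₂ ∷ d} (pe , δd) = begin
  ⟪ tilde (u ∷ x) , e₁ ∷ e₂ ∷ d ⟫K
    ≡⟨ cong (⟪_, e₁ ∷ e₂ ∷ d ⟫K) (tilde-cons u x) ⟩
  ⟪ tilde₁ u ∷ tilde₂ u ∷ tilde x , e₁ ∷ e₂ ∷ d ⟫K
    ≡⟨ dot-pair (tilde₁ u) (tilde₂ u) e₁ e₂ (tilde x) d ⟩
  ((tilde₁ u ·K e₁) xor (tilde₂ u ·K e₂)) xor ⟪ tilde x , d ⟫K
    ≡⟨ cong₂ _xor_ (tilde-⊥-δPair u pe) (tilde-⊥-δ₂ x δd) ⟩
  false ∎

-- (3) Every vector orthogonal to δ₂ⁿ lies in ~(L^n) ⊕ δ₂ⁿ.  Testing z against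
-- (a,a,0,…,0) constrains its first pair; testing against (0,0,d) passes the
-- hypothesis to the remaining coordinates.
δ₂-dual : ∀ n (z : Vec K (double n)) → (∀ d → δ₂ n d → ⟪ z , d ⟫K ≡ false) →
  ∃[ x ] ∃[ d ] (δ₂ n d × z ≡ tilde x ⊕ d)
δ₂-dual zero    []            _   = [] , [] , tt , refl
δ₂-dual (suc n) (p ∷ q ∷ z) z⊥δ
  with δPair-dual p q head-⊥ | δ₂-dual n z tail-⊥
  where
  head-⊥ : (p ·K a) xor (q ·K a) ≡ false
  head-⊥ = begin
    (p ·K a) xor (q ·K a)
      ≡⟨ sym (xor-identityʳ _) ⟩
    ((p ·K a) xor (q ·K a)) xor false
      ≡⟨ cong (((p ·K a) xor (q ·K a)) xor_) (sym (dot-zeroʳ z)) ⟩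
    ((p ·K a) xor (q ·K a)) xor ⟪ z , replicate (double n) 0K ⟫K
      ≡⟨ sym (dot-pair p q a a z (replicate (double n) 0K)) ⟩
    ⟪ p ∷ q ∷ z , a ∷ a ∷ replicate (double n) 0K ⟫K
      ≡⟨ z⊥δ _ (inj₂ (refl , refl) , δ₂-zero n) ⟩
    false ∎
  tail-⊥ : ∀ d → δ₂ n d → ⟪ z , d ⟫K ≡ false
  tail-⊥ d δd = begin
    ⟪ z , d ⟫K
      ≡⟨ sym (cong₂ (λ s t → s xor (t xor ⟪ z , d ⟫K)) (·K-zeroʳ p) (·K-zeroʳ q)) ⟩
    ⟪ p ∷ q ∷ z , 0K ∷ 0K ∷ d ⟫K
      ≡⟨ z⊥δ _ (inj₁ (refl , refl) , δd) ⟩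
    false ∎
... | u , e₁ , e₂ , pe , p≡ , q≡ | x , d , δd , z≡ =
  u ∷ x , e₁ ∷ e₂ ∷ d , (pe , δd) ,
  trans (cong₂ _∷_ p≡ (cong₂ _∷_ q≡ z≡))
        (cong (_⊕ (e₁ ∷ e₂ ∷ d)) (sym (tilde-cons u x)))

tilde-weight-parity : ∀ {n} (x : Vec L n) {d : Vec K (double n)} → δ₂ n d →
  wtK (tilde x ⊕ d) % 2 ≡ ewt x % 2
tilde-weight-parity []      {[]}            _         = refl
tilde-weight-parity (u ∷ x) {e₁ ∷ e₂ ∷ d} (pe , δd) = begin
  wtK (tilde (u ∷ x) ⊕ (e₁ ∷ e₂ ∷ d)) % 2
    ≡⟨ cong (λ t → wtK (t ⊕ (e₁ ∷ e₂ ∷ d)) % 2) (tilde-cons u x) ⟩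
  (w₁ + (w₂ + rest)) % 2             ≡⟨ cong (_% 2) (sym (+-assoc w₁ w₂ rest)) ⟩
  (w₁ + w₂ + rest) % 2               ≡⟨ %-distribˡ-+ (w₁ + w₂) rest 2 ⟩
  ((w₁ + w₂) % 2 + rest % 2) % 2
    ≡⟨ cong₂ (λ s t → (s + t) % 2) (δPair-weight u pe) (tilde-weight-parity x δd) ⟩
  (norm u % 2 + ewt x % 2) % 2       ≡⟨ sym (%-distribˡ-+ (norm u) (ewt x) 2) ⟩
  (norm u + ewt x) % 2               ∎
  where
  w₁ w₂ rest : ℕ
  w₁   = isNonzeroK (tilde₁ u +K e₁)
  w₂   = isNonzeroK (tilde₂ u +K e₂)
  rest = wtK (tilde x ⊕ d)

module _ {n : ℕ} {C : LSubset n} where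

  σ-contains-δ₂ : IsLCode C → ∀ {d} → δ₂ n d → σ C d
  σ-contains-δ₂ isCode {d} δd =
    replicate n 0L , d , IsLCode.zero-mem isCode , δd ,
    sym (trans (cong (_⊕ d) (tilde-zero n)) (⊕-identityˡ d))

  σ-contains-tilde : ∀ {x} → C x → σ C (tilde x)
  σ-contains-tilde {x} Cx =
    x , replicate (double n) 0K , Cx , δ₂-zero n , sym (⊕-identityʳ (tilde x))

  σ-isCode : IsLCode C → IsKCode (σ C)
  σ-isCode isCode = record
    { zero-mem = σ-contains-δ₂ isCode (δ₂-zero n)
    ; +-closed = closed
    }
    where
    closed : ∀ w w' → σ C w → σ C w' → σ C (w ⊕ w')
    closed _ _ (x , d , Cx , δd , refl) (x' , d' , Cx' , δd' , refl) =
      zipWith _+L_ x x' , d ⊕ d' , IsLCode.+-closed isCode x x' Cx Cx' ,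
      δ₂-closed n δd δd' ,
      trans (⊕-interchange (tilde x) d (tilde x') d')
            (cong (_⊕ (d ⊕ d')) (sym (tilde-hom x x')))

  σ-selfOrthogonal : (∀ x y → C x → C y → ⟪ x , y ⟫L ≡ false) →
    ∀ w → σ C w → ∀ w' → σ C w' → ⟪ w , w' ⟫K ≡ false
  σ-selfOrthogonal C⊥C _ (x , d , Cx , δd , refl) _ (x' , d' , Cx' , δd' , refl) = begin
    ⟪ tilde x ⊕ d , tilde x' ⊕ d' ⟫K
      ≡⟨ dot-linearˡ (tilde x) d (tilde x' ⊕ d') ⟩
    ⟪ tilde x , tilde x' ⊕ d' ⟫K xor ⟪ d , tilde x' ⊕ d' ⟫K
      ≡⟨ cong₂ _xor_ (dot-linearʳ (tilde x) (tilde x') d') (dot-linearʳ d (tilde x') d') ⟩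
    (⟪ tilde x , tilde x' ⟫K xor ⟪ tilde x , d' ⟫K) xor (⟪ d , tilde x' ⟫K xor ⟪ d , d' ⟫K)
      ≡⟨ cong₂ _xor_ (cong₂ _xor_ (trans (tilde-isometry x x') (C⊥C x x' Cx Cx'))
                                  (tilde-⊥-δ₂ x δd'))
                     (cong₂ _xor_ (trans (dot-comm d (tilde x')) (tilde-⊥-δ₂ x' δd))
                                  (δ₂-selfOrthogonal n δd δd')) ⟩
    false ∎

  -- If C contains its dual, so does σ(C): by (3) a vector z orthogonal to
  -- σ(C) ⊇ δ₂ⁿ is x̃ ⊕ d, and (x , y) = (z , ỹ) = 0 for y ∈ C puts x in C.
  σ-maximal : IsLCode C → (∀ x → (∀ y → C y → ⟪ x , y ⟫L ≡ false) → C x) →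
    ∀ z → (∀ w → σ C w → ⟪ z , w ⟫K ≡ false) → σ C z
  σ-maximal isCode dual⊆C z z⊥σ
    with δ₂-dual n z (λ d δd → z⊥σ d (σ-contains-δ₂ isCode δd))
  ... | x , d , δd , refl = x , d , dual⊆C x x⊥C , δd , refl
    where
    x⊥C : ∀ y → C y → ⟪ x , y ⟫L ≡ false
    x⊥C y Cy = begin
      ⟪ x , y ⟫L                                   ≡⟨ sym (tilde-isometry x y) ⟩
      ⟪ tilde x , tilde y ⟫K                       ≡⟨ sym (xor-identityʳ _) ⟩
      ⟪ tilde x , tilde y ⟫K xor false
        ≡⟨ cong (⟪ tilde x , tilde y ⟫K xor_)
                (sym (trans (dot-comm d (tilde y)) (tilde-⊥-δ₂ y δd))) ⟩
      ⟪ tilde x , tilde y ⟫K xor ⟪ d , tilde y ⟫K  ≡⟨ sym (dot-linearˡ (tilde x) d (tilde y)) ⟩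
      ⟪ tilde x ⊕ d , tilde y ⟫K                   ≡⟨ z⊥σ (tilde y) (σ-contains-tilde Cy) ⟩
      false ∎

  σ-even : (∀ x → C x → 2 ∣ ewt x) → ∀ w → σ C w → 2 ∣ wtK w
  σ-even evenC _ (x , d , Cx , δd , refl) =
    m%n≡0⇒n∣m (wtK (tilde x ⊕ d)) 2
      (trans (tilde-weight-parity x δd) (n∣m⇒m%n≡0 (ewt x) 2 (evenC x Cx)))

lemma3p17 : ∀ (n : ℕ) (C : LSubset n)
    → (IsSelfDualLCode C → IsSelfDualKCode (σ C))
      × (IsEvenLCode C → IsEvenKCode (σ C))
lemma3p17 n C = selfDual , even
  where
  selfDual : IsSelfDualLCode C → IsSelfDualKCode (σ C)
  selfDual (isCode , dual) =
    σ-isCode isCode ,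
    λ z → σ-selfOrthogonal (λ x y Cx → proj₁ (dual x) Cx y) z
        , σ-maximal isCode (λ x → proj₂ (dual x)) z

  even : IsEvenLCode C → IsEvenKCode (σ C)
  even (isCode , evenC) = σ-isCode isCode , σ-even evenC
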